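{- For every $n\ge 8$, Sepy has a winning strategy in the Dom-start Disjoint Domination Game on the cycle $C_n$.
   Context: For a vertex $v$, $N[v]$ denotes its closed neighborhood. The Disjoint Domination Game on an isolate-free graph $G=(V,E)$: Dom and Sepy alternately choose a previously uncolored vertex $v$ and color it purple or blue (either player may use either color). With $V_p,V_b$ the current color classes, coloring $v$ with $c$ is legal iff $v\notin V_p\cup V_b$ and some $u\in N[v]$ has $N[u]\cap V_c=\emptyset$. A player must make a legal move on his turn (no passing). The game terminates as soon as either (s) some vertex has its whole closed neighborhood colored with a single color (Sepy wins), or (d) both $V_p$ and $V_b$ are dominating sets of $G$ (Dom wins). In the Dom-start game Dom moves first. -}

module Defs where

open import Data.Nat using (ℕ; zero; suc)
open import Data.Fin using (Fin; toℕ; _≟_)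
open import Data.Maybe using (Maybe; just; nothing)
open import Data.Product using (Σ; _×_; ∃; ∃-syntax; _,_)
open import Data.Sum using (_⊎_)
open import Relation.Nullary using (¬_; yes; no)
open import Relation.Binary.PropositionalEquality using (_≡_; _≢_)

data Color : Set where
  purple blue : Color

Graph : ℕ → Set₁
Graph n = Fin n → Fin n → Set

Cycle : (n : ℕ) → Graph n
Cycle n i j =
  (toℕ j ≡ suc (toℕ i)) ⊎ (toℕ i ≡ suc (toℕ j)) ⊎
  ((toℕ i ≡ 0 × suc (toℕ j) ≡ n) ⊎ (toℕ j ≡ 0 × suc (toℕ i) ≡ n))

InN : ∀ {n} → Graph n → Fin n → Fin n → Set
InN G v w = (w ≡ v) ⊎ G v w

-- A game position: partial coloring (nothing = uncolored).
Coloring : ℕ → Set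
Coloring n = Fin n → Maybe Color

NoColorIn : ∀ {n} → Graph n → Coloring n → Fin n → Color → Set
NoColorIn G col u c = ∀ w → InN G u w → col w ≢ just c

Legal : ∀ {n} → Graph n → Coloring n → Fin n → Color → Set
Legal G col v c = (col v ≡ nothing) × (∃[ u ] (InN G v u × NoColorIn G col u c))

Dominating : ∀ {n} → Graph n → Coloring n → Color → Set
Dominating G col c = ∀ u → ∃[ w ] (InN G u w × col w ≡ just c)

DomCond : ∀ {n} → Graph n → Coloring n → Set
DomCond G col = Dominating G col purple × Dominating G col blue

SepyCond : ∀ {n} → Graph n → Coloring n → Set
SepyCond G col = ∃[ v ] ∃[ c ] (∀ w → InN G v w → col w ≡ just c)

update : ∀ {n} → Coloring n → Fin n → Color → Coloring n
update col v c w with w ≟ v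
... | yes _ = just c
... | no  _ = col w

data Player : Set where
  dom sepy : Player

-- SepyWins G p col : from position col with player p to move,
-- Sepy has a winning strategy (the game is finite, so inductive).
data SepyWins {n : ℕ} (G : Graph n) : Player → Coloring n → Set where
  won      : ∀ {p col} → SepyCond G col → SepyWins G p col
  domMove  : ∀ {col} → ¬ SepyCond G col → ¬ DomCond G col →
             (∀ v c → Legal G col v c → SepyWins G sepy (update col v c)) →
             SepyWins G dom col
  sepyMove : ∀ {col} → ¬ SepyCond G col → ¬ DomCond G col → (v : Fin n) (c : Color) →
             Legal G col v c → SepyWins G dom (update col v c) →
             SepyWins G sepy col

empty : ∀ {n} → Coloring n
empty _ = nothing

SepyWinsDomStart : ∀ {n} → Graph n → Set
SepyWinsDomStart G = SepyWins G dom empty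

module Submission where

open import Defs
import Data.Nat as ℕ
open import Data.Nat using (ℕ; zero; suc; _+_; _∸_; _≤_; _<_; _%_; NonZero)
open import Data.Nat.Properties
  using (m≤n⇒m<n∨m≡n; suc-injective; +-assoc; +-comm; +-suc; +-identityʳ; m+[n∸m]≡n; m∸n+n≡m; <⇒≤;
         <-irrefl; <-≤-trans; ≤-trans; ≤-refl; +-monoˡ-<; m≤m+n; m≤n+m; n≤1+n)
open import Data.Nat.DivMod using (m<n⇒m%n≡m; %-distribˡ-+; m%n%n≡m%n; m%n<n; n%n≡0; [m+n]%n≡m%n)
open import Data.Fin using (Fin; zero; suc; toℕ; fromℕ<; _≟_)
open import Data.Fin.Properties using (toℕ-injective; toℕ-fromℕ<; toℕ<n; any?; all?)
open import Data.Maybe using (just; nothing)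
open import Data.Maybe.Properties using (just-injective)
import Data.Maybe.Properties as Maybe
open import Data.Product using (∃; ∃-syntax; _×_; _,_; proj₁; proj₂)
open import Data.Sum using (_⊎_; inj₁; inj₂; map₂)
open import Data.Empty using (⊥; ⊥-elim)
open import Relation.Nullary using (¬_; Dec; yes; no)
open import Relation.Nullary.Decidable using (map′; _⊎-dec_; _×-dec_; _→-dec_)
open import Relation.Binary.Definitions using (DecidableEquality)
open import Relation.Binary.PropositionalEquality
  using (_≡_; _≢_; refl; sym; trans; cong; subst; module ≡-Reasoning)

-- Let x₀ be the vertex of Dom's first move, c its colour, and xᵢ the i-th vertex after
-- x₀ (indices mod n).  Sepy colours x₁ with c; now N[x₀] = {x₋₁, x₀, x₁} and
-- N[x₁] = {x₀, x₁, x₂} each lack one vertex.  Dom's next move w blocks at most one of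
-- these threats: if w ∈ {x₂, x₃, x₄}, then N[x₋₂] is still uncoloured, so colouring
-- x₋₁ with c is legal and completes N[x₀]; otherwise N[x₃] is uncoloured and colouring
-- x₂ with c completes N[x₁].  For n ≥ 8 the vertices x₋₃, …, x₄ are distinct, and Dom
-- cannot win earlier because a colour class with at most one vertex does not dominate C_n.

other : Color → Color
other purple = blue
other blue   = purple

other-≢ : ∀ c → other c ≢ c
other-≢ purple ()
other-≢ blue   ()

_≟ᶜ_ : DecidableEquality Color
purple ≟ᶜ purple = yes refl
purple ≟ᶜ blue   = no λ ()
blue   ≟ᶜ purple = no λ ()
blue   ≟ᶜ blue   = yes refl

∃-Color? : {P : Color → Set} → (∀ c → Dec (P c)) → Dec (∃ P)
∃-Color? P? = map′ (λ { (inj₁ p) → purple , p ; (inj₂ p) → blue , p })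
                   (λ { (purple , p) → inj₁ p ; (blue , p) → inj₂ p })
                   (P? purple ⊎-dec P? blue)

nothing≢just : ∀ {A : Set} {a : A} → nothing ≢ just a
nothing≢just ()

DomCond⇒Dominating : ∀ {n} {G : Graph n} {col} → DomCond G col → ∀ c → Dominating G col c
DomCond⇒Dominating (purple-dominates , _) purple = purple-dominates
DomCond⇒Dominating (_ , blue-dominates)   blue   = blue-dominates

module _ {n : ℕ} where

  update-≡ : ∀ (col : Coloring n) v c → update col v c v ≡ just c
  update-≡ col v c with v ≟ v
  ... | yes _  = refl
  ... | no v≢v = ⊥-elim (v≢v refl)

  update-≢ : ∀ (col : Coloring n) v c z → z ≢ v → update col v c z ≡ col z
  update-≢ col v c z z≢v with z ≟ v
  ... | yes z≡v = ⊥-elim (z≢v z≡v)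
  ... | no _    = refl

  update-just⁻ : ∀ (col : Coloring n) v c z {d} →
                 update col v c z ≡ just d → (z ≡ v × d ≡ c) ⊎ col z ≡ just d
  update-just⁻ col v c z eq with z ≟ v
  ... | yes z≡v = inj₁ (z≡v , sym (just-injective eq))
  ... | no _    = inj₂ eq

  uncoloured : ∀ (col : Coloring n) z → (∀ d → col z ≢ just d) → col z ≡ nothing
  uncoloured col z h with col z
  ... | nothing = refl
  ... | just d  = ⊥-elim (h d refl)

  module _ {G : Graph n} where

    SepyCond? : (∀ i j → Dec (G i j)) → ∀ col → Dec (SepyCond G col)
    SepyCond? G? col = any? λ v → ∃-Color? λ c → all? λ w →
      ((w ≟ v) ⊎-dec G? v w) →-dec Maybe.≡-dec _≟ᶜ_ (col w) (just c)

    legal-if-clear : ∀ {col t u c} → col t ≡ nothing → InN G t u →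
                     (∀ z → InN G u z → col z ≡ nothing) → Legal G col t c
    legal-if-clear {u = u} t-free t∼u clear =
      t-free , u , t∼u , λ z u∼z eq → nothing≢just (trans (sym (clear z u∼z)) eq)

    update-completes : ∀ {col t p c} → col t ≡ nothing →
                       (∀ z → InN G p z → z ≡ t ⊎ col z ≡ just c) →
                       SepyCond G (update col t c)
    update-completes {col} {t} {p} {c} t-free nbhd = p , c , λ z p∼z → paint z (nbhd z p∼z)
      where
      paint : ∀ z → z ≡ t ⊎ col z ≡ just c → update col t c z ≡ just c
      paint z (inj₁ refl) = update-≡ col t c
      paint z (inj₂ eq)   = trans (update-≢ col t c z λ { refl → nothing≢just (trans (sym t-free) eq) }) eq

    winningMove : ∀ {col t c} → Dec (SepyCond G col) → ¬ DomCond G col →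
                  Legal G col t c → SepyCond G (update col t c) → SepyWins G sepy col
    winningMove (yes sepyWon) _ _ _ = won sepyWon
    winningMove {t = t} {c} (no ¬sepyWon) ¬domWon legal sepyWins =
      sepyMove ¬sepyWon ¬domWon t c legal (won sepyWins)

Cycle? : ∀ {n} (i j : Fin n) → Dec (Cycle n i j)
Cycle? {n} i j =
  (toℕ j ℕ.≟ suc (toℕ i)) ⊎-dec (toℕ i ℕ.≟ suc (toℕ j)) ⊎-dec
  (((toℕ i ℕ.≟ 0) ×-dec (suc (toℕ j) ℕ.≟ n)) ⊎-dec
   ((toℕ j ℕ.≟ 0) ×-dec (suc (toℕ i) ℕ.≟ n)))

Cycle-sym : ∀ {n} {i j : Fin n} → Cycle n i j → Cycle n j i
Cycle-sym (inj₁ j≡1+i)               = inj₂ (inj₁ j≡1+i)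
Cycle-sym (inj₂ (inj₁ i≡1+j))        = inj₁ i≡1+j
Cycle-sym (inj₂ (inj₂ (inj₁ wrap)))  = inj₂ (inj₂ (inj₂ wrap))
Cycle-sym (inj₂ (inj₂ (inj₂ wrap)))  = inj₂ (inj₂ (inj₁ wrap))

module _ {n : ℕ} .{{_ : NonZero n}} where

  [a+b%n]%n≡[a+b]%n : ∀ a b → (a + b % n) % n ≡ (a + b) % n
  [a+b%n]%n≡[a+b]%n a b = begin
    (a + b % n) % n           ≡⟨ %-distribˡ-+ a (b % n) n ⟩
    (a % n + b % n % n) % n   ≡⟨ cong (λ r → (a % n + r) % n) (m%n%n≡m%n b n) ⟩
    (a % n + b % n) % n       ≡⟨ sym (%-distribˡ-+ a b n) ⟩
    (a + b) % n               ∎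
    where open ≡-Reasoning

  infix 4 _↦_
  _↦_ : Fin n → Fin n → Set
  i ↦ j = toℕ j ≡ suc (toℕ i) % n

  ≡n⇒%n≡0 : ∀ {a} → a ≡ n → a % n ≡ 0
  ≡n⇒%n≡0 a≡n = trans (cong (_% n) a≡n) (n%n≡0 n)

  successor-cases : ∀ (i : Fin n) →
    suc (toℕ i) % n ≡ suc (toℕ i) ⊎ (suc (toℕ i) ≡ n × suc (toℕ i) % n ≡ 0)
  successor-cases i with m≤n⇒m<n∨m≡n (toℕ<n i)
  ... | inj₁ 1+i<n = inj₁ (m<n⇒m%n≡m 1+i<n)
  ... | inj₂ 1+i≡n = inj₂ (1+i≡n , ≡n⇒%n≡0 1+i≡n)

  ↦⇒Cycle : ∀ {i j} → i ↦ j → Cycle n i j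
  ↦⇒Cycle {i} i↦j with successor-cases i
  ... | inj₁ mod≡           = inj₁ (trans i↦j mod≡)
  ... | inj₂ (1+i≡n , mod≡) = inj₂ (inj₂ (inj₂ (trans i↦j mod≡ , 1+i≡n)))

  Cycle⇒↦ : ∀ {i j} → Cycle n i j → i ↦ j ⊎ j ↦ i
  Cycle⇒↦ {i} {j} (inj₁ j≡1+i) =
    inj₁ (trans j≡1+i (sym (m<n⇒m%n≡m (subst (_< n) j≡1+i (toℕ<n j)))))
  Cycle⇒↦ {i} {j} (inj₂ (inj₁ i≡1+j)) =
    inj₂ (trans i≡1+j (sym (m<n⇒m%n≡m (subst (_< n) i≡1+j (toℕ<n i)))))
  Cycle⇒↦ {i} {j} (inj₂ (inj₂ (inj₁ (i≡0 , 1+j≡n)))) =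
    inj₂ (trans i≡0 (sym (≡n⇒%n≡0 1+j≡n)))
  Cycle⇒↦ {i} {j} (inj₂ (inj₂ (inj₂ (j≡0 , 1+i≡n)))) =
    inj₁ (trans j≡0 (sym (≡n⇒%n≡0 1+i≡n)))

  ↦-functional : ∀ {i j k} → i ↦ j → i ↦ k → j ≡ k
  ↦-functional i↦j i↦k = toℕ-injective (trans i↦j (sym i↦k))

  -- The residue of r modulo n, represented in 1, …, n instead of 0, …, n − 1.
  positiveRep : ℕ → ℕ
  positiveRep zero    = n
  positiveRep (suc r) = suc r

  ↦⇒suc≡ : ∀ {i j} → i ↦ j → suc (toℕ i) ≡ positiveRep (toℕ j)
  ↦⇒suc≡ {i} i↦j with successor-cases i
  ... | inj₁ mod≡           rewrite trans i↦j mod≡ = refl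
  ... | inj₂ (1+i≡n , mod≡) rewrite trans i↦j mod≡ = 1+i≡n

  ↦-injective : ∀ {i j k} → i ↦ k → j ↦ k → i ≡ j
  ↦-injective i↦k j↦k = toℕ-injective (suc-injective (trans (↦⇒suc≡ i↦k) (sym (↦⇒suc≡ j↦k))))

  closedNbhd-↦ : ∀ {i j k y} → i ↦ j → j ↦ k → InN (Cycle n) j y → y ≡ i ⊎ y ≡ j ⊎ y ≡ k
  closedNbhd-↦ i↦j j↦k (inj₁ y≡j) = inj₂ (inj₁ y≡j)
  closedNbhd-↦ i↦j j↦k (inj₂ j∼y) with Cycle⇒↦ j∼y
  ... | inj₁ j↦y = inj₂ (inj₂ (↦-functional j↦y j↦k))
  ... | inj₂ y↦j = inj₁ (↦-injective y↦j i↦j)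

  rotate : Fin n → ℕ → Fin n
  rotate v a = fromℕ< (m%n<n (toℕ v + a) n)

  toℕ-rotate : ∀ v a → toℕ (rotate v a) ≡ (toℕ v + a) % n
  toℕ-rotate v a = toℕ-fromℕ< (m%n<n (toℕ v + a) n)

  rotate-zero : ∀ v → rotate v 0 ≡ v
  rotate-zero v = toℕ-injective (begin
    toℕ (rotate v 0)   ≡⟨ toℕ-rotate v 0 ⟩
    (toℕ v + 0) % n    ≡⟨ cong (_% n) (+-identityʳ (toℕ v)) ⟩
    toℕ v % n          ≡⟨ m<n⇒m%n≡m (toℕ<n v) ⟩
    toℕ v              ∎)
    where open ≡-Reasoning

  rotate-periodic : ∀ v a → rotate v (a + n) ≡ rotate v a
  rotate-periodic v a = toℕ-injective (begin
    toℕ (rotate v (a + n))   ≡⟨ toℕ-rotate v (a + n) ⟩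
    (toℕ v + (a + n)) % n    ≡⟨ cong (_% n) (sym (+-assoc (toℕ v) a n)) ⟩
    (toℕ v + a + n) % n      ≡⟨ [m+n]%n≡m%n (toℕ v + a) n ⟩
    (toℕ v + a) % n          ≡⟨ sym (toℕ-rotate v a) ⟩
    toℕ (rotate v a)         ∎)
    where open ≡-Reasoning

  rotate-↦ : ∀ v a → rotate v a ↦ rotate v (suc a)
  rotate-↦ v a = begin
    toℕ (rotate v (suc a))             ≡⟨ toℕ-rotate v (suc a) ⟩
    (toℕ v + suc a) % n                ≡⟨ cong (_% n) (+-suc (toℕ v) a) ⟩
    suc (toℕ v + a) % n                ≡⟨ sym ([a+b%n]%n≡[a+b]%n 1 (toℕ v + a)) ⟩
    suc ((toℕ v + a) % n) % n          ≡⟨ cong (λ r → suc r % n) (sym (toℕ-rotate v a)) ⟩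
    suc (toℕ (rotate v a)) % n         ∎
    where open ≡-Reasoning

  offset : Fin n → Fin n → ℕ
  offset v w = ((n ∸ toℕ v) + toℕ w) % n

  offset-rotate : ∀ v {a} → a < n → offset v (rotate v a) ≡ a
  offset-rotate v {a} a<n = begin
    ((n ∸ t) + toℕ (rotate v a)) % n   ≡⟨ cong (λ r → ((n ∸ t) + r) % n) (toℕ-rotate v a) ⟩
    ((n ∸ t) + (t + a) % n) % n        ≡⟨ [a+b%n]%n≡[a+b]%n (n ∸ t) (t + a) ⟩
    ((n ∸ t) + (t + a)) % n            ≡⟨ cong (_% n) (sym (+-assoc (n ∸ t) t a)) ⟩
    ((n ∸ t) + t + a) % n              ≡⟨ cong (λ r → (r + a) % n) (m∸n+n≡m (<⇒≤ (toℕ<n v))) ⟩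
    (n + a) % n                        ≡⟨ cong (_% n) (+-comm n a) ⟩
    (a + n) % n                        ≡⟨ [m+n]%n≡m%n a n ⟩
    a % n                              ≡⟨ m<n⇒m%n≡m a<n ⟩
    a                                  ∎
    where
    open ≡-Reasoning
    t = toℕ v

  rotate-injective : ∀ v {a b} → a < n → b < n → rotate v a ≡ rotate v b → a ≡ b
  rotate-injective v {a} {b} a<n b<n eq =
    trans (sym (offset-rotate v a<n)) (trans (cong (offset v) eq) (offset-rotate v b<n))

  rotate-adjacentʳ : ∀ v a → Cycle n (rotate v a) (rotate v (suc a))
  rotate-adjacentʳ v a = ↦⇒Cycle (rotate-↦ v a)

  rotate-adjacentˡ : ∀ v a → Cycle n (rotate v (suc a)) (rotate v a)
  rotate-adjacentˡ v a = Cycle-sym (rotate-adjacentʳ v a)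

  -- The k consecutive vertices rotate v a, …, rotate v (a + k − 1); the offset is
  -- written toℕ i + a so that concrete arcs compute to the expected vertices.
  Arc : Fin n → ℕ → ℕ → Fin n → Set
  Arc v a k z = ∃[ i ] z ≡ rotate v (toℕ {k} i + a)

  Arc? : ∀ v a k z → Dec (Arc v a k z)
  Arc? v a k z = any? λ i → z ≟ rotate v (toℕ i + a)

  Arc-disjoint : ∀ v {a k b l z} → k + a ≤ b → l + b ≤ n → Arc v a k z → Arc v b l z → ⊥
  Arc-disjoint v {a} {k} {b} {l} k+a≤b l+b≤n (i , refl) (j , eq) =
    <-irrefl (rotate-injective v (<-≤-trans i+a<b (≤-trans b≤j+b (<⇒≤ j+b<n))) j+b<n eq)
             (<-≤-trans i+a<b b≤j+b)
    where
    i+a<b : toℕ i + a < b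
    i+a<b = <-≤-trans (+-monoˡ-< a (toℕ<n i)) k+a≤b
    b≤j+b : b ≤ toℕ j + b
    b≤j+b = m≤n+m b (toℕ j)
    j+b<n : toℕ j + b < n
    j+b<n = <-≤-trans (+-monoˡ-< b (toℕ<n j)) l+b≤n

  closedNbhd⊆Arc : ∀ v a {z} → InN (Cycle n) (rotate v (suc a)) z → Arc v a 3 z
  closedNbhd⊆Arc v a z∈N with closedNbhd-↦ (rotate-↦ v a) (rotate-↦ v (suc a)) z∈N
  ... | inj₁ eq        = zero , eq
  ... | inj₂ (inj₁ eq) = suc zero , eq
  ... | inj₂ (inj₂ eq) = suc (suc zero) , eq

module Frame (m : ℕ) (v : Fin (8 + m)) where

  C : Graph (8 + m)
  C = Cycle (8 + m)

  x : ℕ → Fin (8 + m)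
  x = rotate v

  vertex∈Arc : ∀ a → Arc v a 1 (x a)
  vertex∈Arc a = zero , refl

  x₀≢x₁ : x 0 ≢ x 1
  x₀≢x₁ x₀≡x₁ = Arc-disjoint v ≤-refl (m≤m+n 2 (6 + m))
                  (vertex∈Arc 0) (subst (Arc v 1 1) (sym x₀≡x₁) (vertex∈Arc 1))

  x₀-adjacentˡ : C (x 0) (x (7 + m))
  x₀-adjacentˡ = subst (λ y → C y (x (7 + m))) (rotate-periodic v 0) (rotate-adjacentˡ v (7 + m))

  closedNbhd-x₀ : ∀ {z} → InN C (x 0) z → z ≡ x (7 + m) ⊎ Arc v 0 2 z
  closedNbhd-x₀ {z} z∈N
    with closedNbhd⊆Arc v (7 + m) (subst (λ y → InN C y z) (sym (rotate-periodic v 0)) z∈N)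
  ... | zero , eq                   = inj₁ eq
  ... | suc zero , eq           = inj₂ (zero , trans eq (rotate-periodic v 0))
  ... | suc (suc zero) , eq = inj₂ (suc zero , trans eq (rotate-periodic v 1))

  closedNbhd-x₁ : ∀ {z} → InN C (x 1) z → z ≡ x 2 ⊎ Arc v 0 2 z
  closedNbhd-x₁ z∈N with closedNbhd⊆Arc v 0 z∈N
  ... | zero , eq                   = inj₂ (zero , eq)
  ... | suc zero , eq           = inj₂ (suc zero , eq)
  ... | suc (suc zero) , eq = inj₁ eq

  -- N[x₁] and N[x₅₊ₘ] are disjoint, so no single vertex dominates both.
  singleton⇒¬Dominating : ∀ {col d w} → (∀ z → col z ≡ just d → z ≡ w) → ¬ Dominating C col d
  singleton⇒¬Dominating {w = w} only-w dominating
    with dominating (x 1) | dominating (x (5 + m))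
  ... | z₁ , z₁∈N , e₁ | z₂ , z₂∈N , e₂ =
    Arc-disjoint v (m≤m+n 3 (1 + m)) (n≤1+n (7 + m))
      (subst (Arc v 0 3) (only-w z₁ e₁) (closedNbhd⊆Arc v 0 z₁∈N))
      (subst (Arc v (4 + m) 3) (only-w z₂ e₂) (closedNbhd⊆Arc v (4 + m) z₂∈N))

  Painted : Coloring (8 + m) → Color → Set
  Painted col c = ∀ z {d} → col z ≡ just d → Arc v 0 2 z × d ≡ c

  painted⇒¬DomCond : ∀ {col c} → Painted col c → ¬ DomCond C col
  painted⇒¬DomCond {c = c} painted domCond =
    singleton⇒¬Dominating {w = x 0} (λ z e → ⊥-elim (other-≢ c (proj₂ (painted z e))))
      (DomCond⇒Dominating domCond (other c))

  painted⇒¬SepyCond : ∀ {col c} → Painted col c → ¬ SepyCond C col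
  painted⇒¬SepyCond painted (p , d , mono) with proj₁ (painted p (mono p (inj₁ refl)))
  ... | zero , refl =
    Arc-disjoint v (m≤m+n 2 (5 + m)) ≤-refl
      (proj₁ (painted _ (mono _ (inj₂ x₀-adjacentˡ)))) (vertex∈Arc (7 + m))
  ... | suc zero , refl =
    Arc-disjoint v ≤-refl (m≤m+n 3 (5 + m))
      (proj₁ (painted _ (mono _ (inj₂ (rotate-adjacentʳ v 1))))) (vertex∈Arc 2)

  module Strategy (c : Color) where

    col₁ : Coloring (8 + m)
    col₁ = update empty (x 0) c

    col₂ : Coloring (8 + m)
    col₂ = update col₁ (x 1) c

    col₁-just⁻ : ∀ z {d} → col₁ z ≡ just d → z ≡ x 0 × d ≡ c
    col₁-just⁻ z e with update-just⁻ empty (x 0) c z e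
    ... | inj₁ p = p
    ... | inj₂ ()

    painted₁ : Painted col₁ c
    painted₁ z e with col₁-just⁻ z e
    ... | refl , d≡c = (zero , refl) , d≡c

    painted₂ : Painted col₂ c
    painted₂ z e with update-just⁻ col₁ (x 1) c z e
    ... | inj₁ (refl , d≡c) = (suc zero , refl) , d≡c
    ... | inj₂ e₁           = painted₁ z e₁

    col₂-x₀x₁ : ∀ {z} → Arc v 0 2 z → col₂ z ≡ just c
    col₂-x₀x₁ (zero , refl)     = trans (update-≢ col₁ (x 1) c (x 0) x₀≢x₁) (update-≡ empty (x 0) c)
    col₂-x₀x₁ (suc zero , refl)  = update-≡ col₁ (x 1) c

    legal₁ : Legal C col₁ (x 1) c
    legal₁ = legal-if-clear (clear (zero , refl)) (inj₂ (rotate-adjacentʳ v 1))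
               (λ z z∈N → clear (closedNbhd⊆Arc v 1 z∈N))
      where
      clear : ∀ {z} → Arc v 1 3 z → col₁ z ≡ nothing
      clear {z} z∈A = uncoloured col₁ z λ d e →
        Arc-disjoint v ≤-refl (m≤m+n 4 (4 + m))
          (subst (Arc v 0 1) (sym (proj₁ (col₁-just⁻ z e))) (vertex∈Arc 0)) z∈A

    module Reply (w : Fin (8 + m)) (c′ : Color) (w-free : col₂ w ≡ nothing) where

      col₃ : Coloring (8 + m)
      col₃ = update col₂ w c′

      col₃-just⁻ : ∀ z {d} → col₃ z ≡ just d → (z ≡ w × d ≡ c′) ⊎ (Arc v 0 2 z × d ≡ c)
      col₃-just⁻ z e with update-just⁻ col₂ w c′ z e
      ... | inj₁ p  = inj₁ p
      ... | inj₂ e₂ = inj₂ (painted₂ _ e₂)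

      ¬DomCond₃ : ¬ DomCond C col₃
      ¬DomCond₃ domCond = singleton⇒¬Dominating only-w (DomCond⇒Dominating domCond (other c))
        where
        only-w : ∀ z → col₃ z ≡ just (other c) → z ≡ w
        only-w z e with col₃-just⁻ z e
        ... | inj₁ (z≡w , _)     = z≡w
        ... | inj₂ (_ , other≡c) = ⊥-elim (other-≢ c other≡c)

      col₃-x₀x₁ : ∀ {z} → Arc v 0 2 z → col₃ z ≡ just c
      col₃-x₀x₁ {z} z∈A =
        trans (update-≢ col₂ w c′ z λ { refl → nothing≢just (trans (sym w-free) (col₂-x₀x₁ z∈A)) })
              (col₂-x₀x₁ z∈A)

      clear-arc : ∀ {a k z} → ¬ Arc v a k w → 2 ≤ a → k + a ≤ 8 + m → Arc v a k z → col₃ z ≡ nothing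
      clear-arc {z = z} w∉A 2≤a k+a≤n z∈A = uncoloured col₃ z λ d e → coloured (col₃-just⁻ z e)
        where
        coloured : ∀ {d} → (z ≡ w × d ≡ c′) ⊎ (Arc v 0 2 z × d ≡ c) → ⊥
        coloured (inj₁ (refl , _))   = w∉A z∈A
        coloured (inj₂ (z∈x₀x₁ , _)) = Arc-disjoint v 2≤a k+a≤n z∈x₀x₁ z∈A

      -- Dom's move w ∈ {x₂, x₃, x₄} leaves N[x₆₊ₘ] = {x₅₊ₘ, x₆₊ₘ, x₇₊ₘ} uncoloured.
      completeN[x₀] : Arc v 2 3 w → SepyWins C sepy col₃
      completeN[x₀] w∈A =
        winningMove (SepyCond? Cycle? col₃) ¬DomCond₃
          (legal-if-clear x₇₊ₘ-free (inj₂ (rotate-adjacentˡ v (6 + m)))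
            (λ z z∈N → clear (closedNbhd⊆Arc v (5 + m) z∈N)))
          (update-completes x₇₊ₘ-free λ z z∈N → map₂ col₃-x₀x₁ (closedNbhd-x₀ z∈N))
        where
        clear : ∀ {z} → Arc v (5 + m) 3 z → col₃ z ≡ nothing
        clear = clear-arc (Arc-disjoint v (m≤m+n 5 m) ≤-refl w∈A) (m≤m+n 2 (3 + m)) ≤-refl
        x₇₊ₘ-free : col₃ (x (7 + m)) ≡ nothing
        x₇₊ₘ-free = clear (suc (suc zero) , refl)

      completeN[x₁] : ¬ Arc v 2 3 w → SepyWins C sepy col₃
      completeN[x₁] w∉A =
        winningMove (SepyCond? Cycle? col₃) ¬DomCond₃
          (legal-if-clear x₂-free (inj₂ (rotate-adjacentʳ v 2))
            (λ z z∈N → clear (closedNbhd⊆Arc v 2 z∈N)))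
          (update-completes x₂-free λ z z∈N → map₂ col₃-x₀x₁ (closedNbhd-x₁ z∈N))
        where
        clear : ∀ {z} → Arc v 2 3 z → col₃ z ≡ nothing
        clear = clear-arc w∉A ≤-refl (m≤m+n 5 (3 + m))
        x₂-free : col₃ (x 2) ≡ nothing
        x₂-free = clear (zero , refl)

      sepyWinsAfterReply : SepyWins C sepy col₃
      sepyWinsAfterReply with Arc? v 2 3 w
      ... | yes w∈A = completeN[x₀] w∈A
      ... | no  w∉A = completeN[x₁] w∉A

    sepyWinsAfterFirstMove : SepyWins C sepy col₁
    sepyWinsAfterFirstMove =
      sepyMove (painted⇒¬SepyCond painted₁) (painted⇒¬DomCond painted₁) (x 1) c legal₁
        (domMove (painted⇒¬SepyCond painted₂) (painted⇒¬DomCond painted₂)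
          λ w c′ legal → Reply.sepyWinsAfterReply w c′ (proj₁ legal))

sepyWinsDomStart : ∀ m → SepyWinsDomStart (Cycle (8 + m))
sepyWinsDomStart m =
  domMove (λ { (p , _ , mono) → nothing≢just (mono p (inj₁ refl)) })
          (λ { (purple-dominates , _) → nothing≢just (proj₂ (proj₂ (purple-dominates zero))) })
          λ v c _ → subst (λ y → SepyWins (Cycle (8 + m)) sepy (update empty y c)) (rotate-zero v)
                          (Frame.Strategy.sepyWinsAfterFirstMove m v c)

mainTheorem7 : (n : ℕ) → 8 ≤ n → SepyWinsDomStart (Cycle n)
mainTheorem7 n 8≤n = subst (λ k → SepyWinsDomStart (Cycle k)) (m+[n∸m]≡n 8≤n) (sepyWinsDomStart (n ∸ 8))
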